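{- Let $G_1=(V_1,E_1)$ and $G_2=(V_2,E_2)$ be finite connected undirected graphs, $q_1\in V_1$, $q_2\in V_2$. Let $f_1$ be a $G_1$-parking function with respect to $q_1$ and $f_2$ a $G_2$-parking function with respect to $q_2$. Define $f_1\Box f_2:V_1\times V_2\to\mathbb{Z}$ by $(f_1\Box f_2)(u,v)=f_1(u)+f_2(v)+1$. Then $f_1\Box f_2$ is a $G_1\Box G_2$-parking function with respect to $(q_1,q_2)$. Further, if $f_1$ and $f_2$ are maximum parking functions, then $f_1\Box f_2$ is a maximum parking function.
   Context: The Cartesian product $G_1\Box G_2$ has vertex set $V_1\times V_2$ and edges $\{(u_1,v),(u_2,v)\}$ for $\{u_1,u_2\}\in E_1$, $v\in V_2$, and $\{(u,v_1),(u,v_2)\}$ for $u\in V_1$, $\{v_1,v_2\}\in E_2$. For a graph $G=(V,E)$, $A\subseteq V$ and $v\in A$, $d_{\overline{A}}(v)$ is the number of edges $vw$ with $w\notin A$; a $G$-parking function with respect to $q$ is $f:V\to\mathbb{Z}_{\geq -1}$ with $f(q)=-1$ such that every non-empty $A\subseteq V\setminus\{q\}$ contains $v$ with $0\leq f(v)<d_{\overline{A}}(v)$. A maximum parking function is one maximizing $\sum_v f(v)$ among all $G$-parking functions with respect to $q$. -}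

module Defs where

open import Data.Bool using (Bool; true; false; _∧_; _∨_; not; if_then_else_)
open import Data.Nat using (ℕ; zero; suc)
import Data.Nat as ℕ
open import Data.Integer using (ℤ; +_; -[1+_]; _+_; _≤_; _<_)
open import Data.List using (List; []; _∷_; cartesianProduct; foldr; map)
open import Data.List.Membership.Propositional using (_∈_)
open import Data.List.Membership.Propositional.Properties using (∈-cartesianProduct⁺)
open import Data.List.Relation.Unary.Unique.Propositional using (Unique)
open import Data.List.Relation.Unary.Unique.Propositional.Properties using (cartesianProduct⁺)
open import Data.Product using (Σ; ∃; _×_; _,_; proj₁; proj₂)
open import Data.Product.Properties using (≡-dec)
open import Relation.Binary.Definitions using (DecidableEquality)
open import Relation.Binary.PropositionalEquality using (_≡_; refl; cong₂; sym)
open import Relation.Nullary.Decidable using (⌊_⌋; yes; no)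
open import Data.Bool.Properties using (∧-zeroʳ)
open import Data.Empty using (⊥-elim)

record Graph : Set₁ where
  field
    V        : Set
    _≟V_     : DecidableEquality V
    enum     : List V
    complete : ∀ v → v ∈ enum
    unique   : Unique enum
    adj      : V → V → Bool
    adj-sym  : ∀ u v → adj u v ≡ adj v u
    adj-irr  : ∀ v → adj v v ≡ false

open Graph public

⌊≟⌋-sym : {A : Set} (d : DecidableEquality A) (a b : A) → ⌊ d a b ⌋ ≡ ⌊ d b a ⌋
⌊≟⌋-sym d a b with d a b | d b a
... | yes _ | yes _ = refl
... | no _  | no _  = refl
... | yes p | no ¬q = ⊥-elim (¬q (sym p))
... | no ¬p | yes q = ⊥-elim (¬p (sym q))

data Reachable (G : Graph) : V G → V G → Set where
  here  : ∀ {u} → Reachable G u u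
  there : ∀ {u w v} → adj G u w ≡ true → Reachable G w v → Reachable G u v

Connected : Graph → Set
Connected G = ∀ u v → Reachable G u v

count : {A : Set} → (A → Bool) → List A → ℕ
count p [] = 0
count p (x ∷ xs) = if p x then suc (count p xs) else count p xs

-- subsets of V are Boolean predicates (every subset of a finite set is decidable)
Subset : Graph → Set
Subset G = V G → Bool

dOut : (G : Graph) → Subset G → V G → ℕ
dOut G A v = count (λ w → adj G v w ∧ not (A w)) (enum G)

IsParking : (G : Graph) → V G → (V G → ℤ) → Set
IsParking G q f =
  (∀ v → -[1+ 0 ] ≤ f v) ×
  (f q ≡ -[1+ 0 ]) ×
  (∀ (A : Subset G) → A q ≡ false → (∃ λ v → A v ≡ true) →
     ∃ λ v → (A v ≡ true) × (+ 0 ≤ f v) × (f v < + dOut G A v))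

total : (G : Graph) → (V G → ℤ) → ℤ
total G f = foldr (λ v s → f v + s) (+ 0) (enum G)

IsMaxParking : (G : Graph) → V G → (V G → ℤ) → Set
IsMaxParking G q f =
  IsParking G q f × (∀ g → IsParking G q g → total G g ≤ total G f)

_□_ : Graph → Graph → Graph
G₁ □ G₂ = record
  { V        = V G₁ × V G₂
  ; _≟V_     = ≡-dec (_≟V_ G₁) (_≟V_ G₂)
  ; enum     = cartesianProduct (enum G₁) (enum G₂)
  ; complete = λ { (u , v) → ∈-cartesianProduct⁺ (complete G₁ u) (complete G₂ v) }
  ; unique   = cartesianProduct⁺ (unique G₁) (unique G₂)
  ; adj      = adj×
  ; adj-sym  = sym×
  ; adj-irr  = irr×
  }
  where
  adj× : V G₁ × V G₂ → V G₁ × V G₂ → Bool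
  adj× (u₁ , v₁) (u₂ , v₂) =
    (adj G₁ u₁ u₂ ∧ ⌊ _≟V_ G₂ v₁ v₂ ⌋) ∨ (⌊ _≟V_ G₁ u₁ u₂ ⌋ ∧ adj G₂ v₁ v₂)
  sym× : ∀ x y → adj× x y ≡ adj× y x
  sym× (u₁ , v₁) (u₂ , v₂)
    rewrite adj-sym G₁ u₁ u₂ | adj-sym G₂ v₁ v₂
          | ⌊≟⌋-sym (_≟V_ G₁) u₁ u₂ | ⌊≟⌋-sym (_≟V_ G₂) v₁ v₂ = refl
  irr× : ∀ x → adj× x x ≡ false
  irr× (u , v) rewrite adj-irr G₁ u | adj-irr G₂ v
    = ∧-zeroʳ ⌊ _≟V_ G₁ u u ⌋

_⊡_ : {G₁ G₂ : Graph} → (V G₁ → ℤ) → (V G₂ → ℤ) → V G₁ × V G₂ → ℤ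
(f₁ ⊡ f₂) (u , v) = f₁ u + f₂ v + + 1

module Submission where

-- Write mass f = Σ_v (f v + 1) = total f + |V|. A parking function g can be burnt from q one vertex
-- at a time: the parking condition for the unburnt set yields an unburnt z with g z + 1 at most the
-- number of edges from z to the burnt set, so 2 · mass g ≤ Σ_v deg v = 2 |E|. Conversely, on a
-- connected graph, burning along edges and labelling each newly burnt vertex by its number of burnt
-- neighbours minus one gives a parking function of mass |E|. So on connected graphs the maximum
-- parking functions are those of mass |E|. For the product, the parking condition of f₁ □ f₂ on a set
-- A follows from that of f₁ on the projection of A to G₁ and that of f₂ on the fibre of A over the
-- chosen vertex; and if f₁, f₂ are maximum, then
-- mass (f₁ □ f₂) = |V₂| mass f₁ + |V₁| mass f₂ = |V₂| |E₁| + |V₁| |E₂| ≥ |E(G₁ □ G₂)|.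

open import Defs
open import Data.Product using (_×_; _,_)
open import Data.Integer using (ℤ)

import Algebra.Properties.CommutativeSemigroup
open import Data.Empty using (⊥; ⊥-elim)
open import Data.Bool using (Bool; true; false; _∧_; _∨_; not; if_then_else_)
open import Data.Bool.Properties
  using (∨-identityʳ; ∨-zeroʳ; ∧-identityʳ; ∧-zeroʳ; ∧-conicalˡ; ∧-conicalʳ; not-injective; not-involutive; ¬-not)
  renaming (_≟_ to _≟ᵇ_)
open import Data.Integer as ℤ using (+_; -[1+_]; +≤+; -≤+; -≤-; +<+; -<+)
import Data.Integer.Properties as ℤₚ
open import Data.List using (List; []; _∷_; _++_; map; length; foldr; cartesianProduct)
open import Data.List.Membership.Propositional using (_∈_; lose)
open import Data.List.Relation.Unary.All using (All; []; _∷_)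
open import Data.List.Relation.Unary.AllPairs using (_∷_)
open import Data.List.Relation.Unary.Any using (here; there; any?; satisfied)
open import Data.List.Relation.Unary.Unique.Propositional using (Unique)
open import Data.Nat using (ℕ; zero; suc; _+_; _*_; _≤_; _<_; z≤n; s≤s)
open import Data.Nat.Properties
open import Data.Product using (∃; proj₁)
open import Data.Sum using (_⊎_; inj₁; inj₂)
open import Function using (_∘_; case_of_)
open import Relation.Binary.Definitions using (DecidableEquality)
open import Relation.Binary.PropositionalEquality
open import Relation.Nullary using (yes; no)
open import Relation.Nullary.Decidable using (⌊_⌋)

private
  module ℕ+ = Algebra.Properties.CommutativeSemigroup +-commutativeSemigroup
  module ℕ* = Algebra.Properties.CommutativeSemigroup *-commutativeSemigroup
  module ℤ+ = Algebra.Properties.CommutativeSemigroup ℤₚ.+-commutativeSemigroup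

-- Finite sums

∑ : {A : Set} → List A → (A → ℕ) → ℕ
∑ []       f = 0
∑ (x ∷ xs) f = f x + ∑ xs f

syntax ∑ xs (λ x → e) = ∑[ x ∈ xs ] e

module _ {A : Set} where

  ∑-cong : (xs : List A) {f g : A → ℕ} → (∀ x → f x ≡ g x) → ∑ xs f ≡ ∑ xs g
  ∑-cong []       f≗g = refl
  ∑-cong (x ∷ xs) f≗g = cong₂ _+_ (f≗g x) (∑-cong xs f≗g)

  ∑-mono-≤ : (xs : List A) {f g : A → ℕ} → (∀ x → f x ≤ g x) → ∑ xs f ≤ ∑ xs g
  ∑-mono-≤ []       f≤g = z≤n
  ∑-mono-≤ (x ∷ xs) f≤g = +-mono-≤ (f≤g x) (∑-mono-≤ xs f≤g)

  ∑-distrib-+ : (xs : List A) (f g : A → ℕ) → ∑[ x ∈ xs ] (f x + g x) ≡ ∑ xs f + ∑ xs g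
  ∑-distrib-+ []       f g = refl
  ∑-distrib-+ (x ∷ xs) f g =
    trans (cong (_+_ (f x + g x)) (∑-distrib-+ xs f g)) (ℕ+.interchange (f x) (g x) _ _)

  ∑-distribˡ-* : (xs : List A) (c : ℕ) (f : A → ℕ) → ∑[ x ∈ xs ] (c * f x) ≡ c * ∑ xs f
  ∑-distribˡ-* []       c f = sym (*-zeroʳ c)
  ∑-distribˡ-* (x ∷ xs) c f =
    trans (cong (_+_ (c * f x)) (∑-distribˡ-* xs c f)) (sym (*-distribˡ-+ c (f x) _))

  ∑-const : (xs : List A) (c : ℕ) → ∑ xs (λ _ → c) ≡ length xs * c
  ∑-const []       c = refl
  ∑-const (x ∷ xs) c = cong (_+_ c) (∑-const xs c)

  ∑-++ : (xs ys : List A) (f : A → ℕ) → ∑ (xs ++ ys) f ≡ ∑ xs f + ∑ ys f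
  ∑-++ []       ys f = refl
  ∑-++ (x ∷ xs) ys f = trans (cong (_+_ (f x)) (∑-++ xs ys f)) (sym (+-assoc (f x) _ _))

  ∑-∈-≤ : {xs : List A} (f : A → ℕ) {x : A} → x ∈ xs → f x ≤ ∑ xs f
  ∑-∈-≤         f (here refl)  = m≤m+n (f _) _
  ∑-∈-≤ {y ∷ _} f (there x∈xs) = m≤n⇒m≤o+n (f y) (∑-∈-≤ f x∈xs)

∑-map : {A B : Set} (g : A → B) (xs : List A) (f : B → ℕ) → ∑ (map g xs) f ≡ ∑[ x ∈ xs ] f (g x)
∑-map g []       f = refl
∑-map g (x ∷ xs) f = cong (_+_ (f (g x))) (∑-map g xs f)

module _ {A B : Set} where

  ∑-cartesianProduct : (xs : List A) (ys : List B) (f : A × B → ℕ) →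
    ∑ (cartesianProduct xs ys) f ≡ ∑[ x ∈ xs ] ∑[ y ∈ ys ] f (x , y)
  ∑-cartesianProduct []       ys f = refl
  ∑-cartesianProduct (x ∷ xs) ys f =
    trans (∑-++ (map (x ,_) ys) _ f)
          (cong₂ _+_ (∑-map (x ,_) ys f) (∑-cartesianProduct xs ys f))

  ∑∑-separate : (xs : List A) (ys : List B) (f : A → ℕ) (g : B → ℕ) →
    ∑[ x ∈ xs ] ∑[ y ∈ ys ] (f x + g y) ≡ length ys * ∑ xs f + length xs * ∑ ys g
  ∑∑-separate xs ys f g = begin
    ∑[ x ∈ xs ] ∑[ y ∈ ys ] (f x + g y)
      ≡⟨ ∑-cong xs (λ x → trans (∑-distrib-+ ys (λ _ → f x) g)
                               (cong (_+ ∑ ys g) (∑-const ys (f x)))) ⟩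
    ∑[ x ∈ xs ] (length ys * f x + ∑ ys g)
      ≡⟨ ∑-distrib-+ xs _ _ ⟩
    ∑[ x ∈ xs ] (length ys * f x) + ∑ xs (λ _ → ∑ ys g)
      ≡⟨ cong₂ _+_ (∑-distribˡ-* xs (length ys) f) (∑-const xs (∑ ys g)) ⟩
    length ys * ∑ xs f + length xs * ∑ ys g ∎
    where open ≡-Reasoning

𝟙 : Bool → ℕ
𝟙 true  = 1
𝟙 false = 0

𝟙-∧ : ∀ a b → 𝟙 (a ∧ b) ≡ 𝟙 a * 𝟙 b
𝟙-∧ true  b = sym (+-identityʳ (𝟙 b))
𝟙-∧ false b = refl

𝟙-∨-≤ : ∀ a b → 𝟙 (a ∨ b) ≤ 𝟙 a + 𝟙 b
𝟙-∨-≤ true  b = s≤s z≤n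
𝟙-∨-≤ false b = ≤-refl

𝟙-mono : ∀ {a b} → (a ≡ true → b ≡ true) → 𝟙 a ≤ 𝟙 b
𝟙-mono {false} _   = z≤n
𝟙-mono {true}  a⇒b rewrite a⇒b refl = ≤-refl

module _ {A : Set} (_≟_ : DecidableEquality A) where

  ∑-indicator-∉ : {xs : List A} {z : A} (f : A → ℕ) →
    All (z ≢_) xs → ∑[ y ∈ xs ] (𝟙 ⌊ z ≟ y ⌋ * f y) ≡ 0
  ∑-indicator-∉ f [] = refl
  ∑-indicator-∉ {y ∷ _} {z} f (z≢y ∷ z∉ys) with z ≟ y
  ... | yes z≡y = ⊥-elim (z≢y z≡y)
  ... | no  _   = ∑-indicator-∉ f z∉ys

  ∑-indicator : {xs : List A} {z : A} (f : A → ℕ) →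
    Unique xs → z ∈ xs → ∑[ y ∈ xs ] (𝟙 ⌊ z ≟ y ⌋ * f y) ≡ f z
  ∑-indicator {y ∷ _} {z} f (y∉ys ∷ ys-unique) z∈y∷ys with z ≟ y | z∈y∷ys
  ... | yes refl | _           = trans (cong (_+_ (f z + 0)) (∑-indicator-∉ f y∉ys))
                                       (trans (+-identityʳ _) (+-identityʳ (f z)))
  ... | no  z≢y  | here z≡y    = ⊥-elim (z≢y z≡y)
  ... | no  _    | there z∈ys = ∑-indicator f ys-unique z∈ys

module _ {A : Set} where

  count≡∑ : (p : A → Bool) (xs : List A) → count p xs ≡ ∑[ x ∈ xs ] 𝟙 (p x)
  count≡∑ p []       = refl
  count≡∑ p (x ∷ xs) with p x
  ... | true  = cong suc (count≡∑ p xs)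
  ... | false = count≡∑ p xs

  count-cong : (xs : List A) {p q : A → Bool} → (∀ x → p x ≡ q x) → count p xs ≡ count q xs
  count-cong xs p≗q =
    trans (count≡∑ _ xs) (trans (∑-cong xs (cong 𝟙 ∘ p≗q)) (sym (count≡∑ _ xs)))

  count-mono : (xs : List A) {p q : A → Bool} →
    (∀ x → p x ≡ true → q x ≡ true) → count p xs ≤ count q xs
  count-mono xs {p} {q} p⇒q =
    subst₂ _≤_ (sym (count≡∑ p xs)) (sym (count≡∑ q xs)) (∑-mono-≤ xs (𝟙-mono ∘ p⇒q))

  count-∈ : {xs : List A} (p : A → Bool) {x : A} → x ∈ xs → p x ≡ true → 0 < count p xs
  count-∈ {xs} p x∈xs px =
    subst (1 ≤_) (sym (count≡∑ p xs)) (subst (_≤ _) (cong 𝟙 px) (∑-∈-≤ (𝟙 ∘ p) x∈xs))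

  count-none : (xs : List A) {p : A → Bool} → (∀ x → p x ≡ false) → count p xs ≡ 0
  count-none []       none = refl
  count-none (x ∷ xs) none rewrite none x = count-none xs none

-- Integers ≥ -1 shifted to naturals

-- For z ≥ -1 this is z + 1; smaller integers are sent to 0 as well.
toℕ₊₁ : ℤ → ℕ
toℕ₊₁ (+ n)    = suc n
toℕ₊₁ -[1+ n ] = 0

fromℕ₋₁ : ℕ → ℤ
fromℕ₋₁ zero    = -[1+ 0 ]
fromℕ₋₁ (suc n) = + n

toℕ₊₁-fromℕ₋₁ : ∀ n → toℕ₊₁ (fromℕ₋₁ n) ≡ n
toℕ₊₁-fromℕ₋₁ zero    = refl
toℕ₊₁-fromℕ₋₁ (suc n) = refl

-1≤fromℕ₋₁ : ∀ n → -[1+ 0 ] ℤ.≤ fromℕ₋₁ n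
-1≤fromℕ₋₁ zero    = -≤- z≤n
-1≤fromℕ₋₁ (suc n) = -≤+

0<⇒0≤fromℕ₋₁ : ∀ {n} → 0 < n → + 0 ℤ.≤ fromℕ₋₁ n
0<⇒0≤fromℕ₋₁ (s≤s _) = +≤+ z≤n

≤⇒fromℕ₋₁< : ∀ {n d} → n ≤ d → fromℕ₋₁ n ℤ.< + d
≤⇒fromℕ₋₁< {zero}  _        = -<+
≤⇒fromℕ₋₁< {suc n} (s≤s n≤d) = +<+ (s≤s n≤d)

+toℕ₊₁ : ∀ {z} → -[1+ 0 ] ℤ.≤ z → + toℕ₊₁ z ≡ z ℤ.+ + 1
+toℕ₊₁ { + n }          _        = cong +_ (+-comm 1 n)
+toℕ₊₁ { -[1+ 0 ] }     _        = refl
+toℕ₊₁ { -[1+ suc n ] } (-≤- ())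

<⇒toℕ₊₁≤ : ∀ {z d} → z ℤ.< + d → toℕ₊₁ z ≤ d
<⇒toℕ₊₁≤ (+<+ n<d) = n<d
<⇒toℕ₊₁≤ -<+       = z≤n

toℕ₊₁≤⇒< : ∀ {z d} → toℕ₊₁ z ≤ d → z ℤ.< + d
toℕ₊₁≤⇒< { + n }      n<d = +<+ n<d
toℕ₊₁≤⇒< { -[1+ n ] } _   = -<+

0<toℕ₊₁⇒0≤ : ∀ {z} → 0 < toℕ₊₁ z → + 0 ℤ.≤ z
0<toℕ₊₁⇒0≤ { + n } _ = +≤+ z≤n

0≤⇒0<toℕ₊₁ : ∀ {z} → + 0 ℤ.≤ z → 0 < toℕ₊₁ z
0≤⇒0<toℕ₊₁ (+≤+ _) = s≤s z≤n

-1≤a+b+1 : ∀ {a b} → -[1+ 0 ] ℤ.≤ a → -[1+ 0 ] ℤ.≤ b → -[1+ 0 ] ℤ.≤ a ℤ.+ b ℤ.+ + 1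
-1≤a+b+1 -1≤a -1≤b = ℤₚ.+-mono-≤ (ℤₚ.+-mono-≤ -1≤a -1≤b) (ℤₚ.≤-refl {+ 1})

toℕ₊₁[a+b+1] : ∀ {a b} → -[1+ 0 ] ℤ.≤ a → -[1+ 0 ] ℤ.≤ b →
  toℕ₊₁ (a ℤ.+ b ℤ.+ + 1) ≡ toℕ₊₁ a + toℕ₊₁ b
toℕ₊₁[a+b+1] {a} {b} -1≤a -1≤b = ℤₚ.+-injective (begin
  + toℕ₊₁ (a ℤ.+ b ℤ.+ + 1)       ≡⟨ +toℕ₊₁ (-1≤a+b+1 -1≤a -1≤b) ⟩
  (a ℤ.+ b ℤ.+ + 1) ℤ.+ + 1       ≡⟨ ℤₚ.+-assoc (a ℤ.+ b) (+ 1) (+ 1) ⟩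
  (a ℤ.+ b) ℤ.+ (+ 1 ℤ.+ + 1)     ≡⟨ ℤ+.interchange a b (+ 1) (+ 1) ⟩
  (a ℤ.+ + 1) ℤ.+ (b ℤ.+ + 1)     ≡⟨ sym (cong₂ ℤ._+_ (+toℕ₊₁ -1≤a) (+toℕ₊₁ -1≤b)) ⟩
  + toℕ₊₁ a ℤ.+ + toℕ₊₁ b ∎)
  where open ≡-Reasoning

+∑toℕ₊₁ : {A : Set} (f : A → ℤ) (xs : List A) → (∀ x → -[1+ 0 ] ℤ.≤ f x) →
  + ∑[ x ∈ xs ] toℕ₊₁ (f x) ≡ foldr (λ x s → f x ℤ.+ s) (+ 0) xs ℤ.+ + length xs
+∑toℕ₊₁ f []       _    = refl
+∑toℕ₊₁ f (x ∷ xs) -1≤f = begin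
  + toℕ₊₁ (f x) ℤ.+ + ∑[ y ∈ xs ] toℕ₊₁ (f y)
    ≡⟨ cong₂ ℤ._+_ (+toℕ₊₁ (-1≤f x)) (+∑toℕ₊₁ f xs -1≤f) ⟩
  (f x ℤ.+ + 1) ℤ.+ (s ℤ.+ + length xs)
    ≡⟨ ℤ+.interchange (f x) (+ 1) s (+ length xs) ⟩
  (f x ℤ.+ s) ℤ.+ (+ 1 ℤ.+ + length xs) ∎
  where
  open ≡-Reasoning
  s : ℤ
  s = foldr (λ y t → f y ℤ.+ t) (+ 0) xs

+-cancelʳ-≤ᶻ : ∀ {a b} c → a ℤ.+ c ℤ.≤ b ℤ.+ c → a ℤ.≤ b
+-cancelʳ-≤ᶻ {a} {b} c a+c≤b+c =
  subst₂ ℤ._≤_ (cancel a) (cancel b) (ℤₚ.+-monoˡ-≤ (ℤ.- c) a+c≤b+c)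
  where
  cancel : ∀ x → x ℤ.+ c ℤ.+ ℤ.- c ≡ x
  cancel x = trans (ℤₚ.+-assoc x c (ℤ.- c))
                   (trans (cong (ℤ._+_ x) (ℤₚ.+-inverseʳ c)) (ℤₚ.+-identityʳ x))

-- Parking functions of mass |E|

module _ (G : Graph) where

  deg : V G → ℕ
  deg v = count (adj G v) (enum G)

  degreeSum : ℕ
  degreeSum = ∑ (enum G) deg

  mass : (V G → ℤ) → ℕ
  mass f = ∑[ v ∈ enum G ] toℕ₊₁ (f v)

  +mass : ∀ {f} → (∀ v → -[1+ 0 ] ℤ.≤ f v) → + mass f ≡ total G f ℤ.+ + length (enum G)
  +mass {f} = +∑toℕ₊₁ f (enum G)

  total≤⇒mass≤ : ∀ {f g} → (∀ v → -[1+ 0 ] ℤ.≤ f v) → (∀ v → -[1+ 0 ] ℤ.≤ g v) →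
    total G f ℤ.≤ total G g → mass f ≤ mass g
  total≤⇒mass≤ -1≤f -1≤g f≤g = ℤₚ.drop‿+≤+
    (subst₂ ℤ._≤_ (sym (+mass -1≤f)) (sym (+mass -1≤g)) (ℤₚ.+-monoˡ-≤ (+ length (enum G)) f≤g))

  mass≤⇒total≤ : ∀ {f g} → (∀ v → -[1+ 0 ] ℤ.≤ f v) → (∀ v → -[1+ 0 ] ℤ.≤ g v) →
    mass f ≤ mass g → total G f ℤ.≤ total G g
  mass≤⇒total≤ -1≤f -1≤g f≤g = +-cancelʳ-≤ᶻ (+ length (enum G))
    (subst₂ ℤ._≤_ (+mass -1≤f) (+mass -1≤g) (+≤+ f≤g))

  parking-nonempty : ∀ {q f} → IsParking G q f → (A : Subset G) → (∃ λ v → A v ≡ true) →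
    ∃ λ v → A v ≡ true × (v ≡ q ⊎ + 0 ℤ.≤ f v) × f v ℤ.< + dOut G A v
  parking-nonempty {q} (_ , fq≡-1 , parks) A nonempty with A q in Aq
  ... | true  = q , Aq , inj₁ refl , subst (ℤ._< + dOut G A q) (sym fq≡-1) -<+
  ... | false with parks A Aq nonempty
  ...   | v , Av , 0≤fv , fv<d = v , Av , inj₂ 0≤fv , fv<d

  any-vertex? : (p : Subset G) → (∃ λ v → p v ≡ true) ⊎ (∀ v → p v ≡ false)
  any-vertex? p with any? (λ v → p v ≟ᵇ true) (enum G)
  ... | yes found = inj₁ (satisfied found)
  ... | no  none  = inj₂ (λ v → ¬-not (λ pv → none (lose (complete G v) pv)))

  dIn : Subset G → V G → ℕ
  dIn S v = count (λ w → adj G v w ∧ S w) (enum G)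

  dOut-not : ∀ S v → dOut G (not ∘ S) v ≡ dIn S v
  dOut-not S v = count-cong (enum G) (λ w → cong (adj G v w ∧_) (not-involutive (S w)))

  ⌊≟⌋-refl : ∀ v → ⌊ _≟V_ G v v ⌋ ≡ true
  ⌊≟⌋-refl v with _≟V_ G v v
  ... | yes _    = refl
  ... | no  v≢v = ⊥-elim (v≢v refl)

  singleton : V G → Subset G
  singleton q v = ⌊ _≟V_ G q v ⌋

  insert : V G → Subset G → Subset G
  insert z S v = S v ∨ ⌊ _≟V_ G z v ⌋

  ∑⟨_⟩ : Subset G → (V G → ℕ) → ℕ
  ∑⟨ S ⟩ w = ∑[ v ∈ enum G ] (𝟙 (S v) * w v)

  -- Twice the number of edges with both ends in S.
  degreeSumIn : Subset G → ℕ
  degreeSumIn S = ∑⟨ S ⟩ (dIn S)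

  ∑-δ : (z : V G) (w : V G → ℕ) → ∑[ v ∈ enum G ] (𝟙 ⌊ _≟V_ G z v ⌋ * w v) ≡ w z
  ∑-δ z w = ∑-indicator (_≟V_ G) w (unique G) (complete G z)

  𝟙-insert : ∀ S {z} → S z ≡ false → ∀ v → 𝟙 (insert z S v) ≡ 𝟙 (S v) + 𝟙 ⌊ _≟V_ G z v ⌋
  𝟙-insert S {z} Sz v with _≟V_ G z v
  ... | yes refl rewrite Sz = refl
  ... | no  _    rewrite ∨-identityʳ (S v) = sym (+-identityʳ _)

  𝟙-not-insert : ∀ S {z} → S z ≡ false → ∀ v →
    𝟙 (not (S v)) ≡ 𝟙 (not (insert z S v)) + 𝟙 ⌊ _≟V_ G z v ⌋
  𝟙-not-insert S {z} Sz v with _≟V_ G z v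
  ... | yes refl rewrite Sz = refl
  ... | no  _    rewrite ∨-identityʳ (S v) = sym (+-identityʳ _)

  ∑⟨⟩-cong : ∀ S {w w′ : V G → ℕ} → (∀ v → S v ≡ true → w v ≡ w′ v) → ∑⟨ S ⟩ w ≡ ∑⟨ S ⟩ w′
  ∑⟨⟩-cong S w≗w′ = ∑-cong (enum G) pointwise
    where
    pointwise : ∀ v → 𝟙 (S v) * _ ≡ 𝟙 (S v) * _
    pointwise v with S v in Sv
    ... | true  = cong (_+ 0) (w≗w′ v Sv)
    ... | false = refl

  ∑⟨⟩-distrib-+ : ∀ S (w w′ : V G → ℕ) → ∑⟨ S ⟩ (λ v → w v + w′ v) ≡ ∑⟨ S ⟩ w + ∑⟨ S ⟩ w′
  ∑⟨⟩-distrib-+ S w w′ =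
    trans (∑-cong (enum G) (λ v → *-distribˡ-+ (𝟙 (S v)) (w v) (w′ v))) (∑-distrib-+ (enum G) _ _)

  ∑⟨singleton⟩ : ∀ q w → ∑⟨ singleton q ⟩ w ≡ w q
  ∑⟨singleton⟩ = ∑-δ

  ∑⟨insert⟩ : ∀ S {z} → S z ≡ false → (w : V G → ℕ) → ∑⟨ insert z S ⟩ w ≡ ∑⟨ S ⟩ w + w z
  ∑⟨insert⟩ S {z} Sz w = begin
    ∑⟨ insert z S ⟩ w
      ≡⟨ ∑-cong (enum G) (λ v → trans (cong (_* w v) (𝟙-insert S Sz v))
                                      (*-distribʳ-+ (w v) (𝟙 (S v)) _)) ⟩
    ∑[ v ∈ enum G ] (𝟙 (S v) * w v + 𝟙 ⌊ _≟V_ G z v ⌋ * w v)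
      ≡⟨ ∑-distrib-+ (enum G) _ _ ⟩
    ∑⟨ S ⟩ w + ∑[ v ∈ enum G ] (𝟙 ⌊ _≟V_ G z v ⌋ * w v)
      ≡⟨ cong (_+_ (∑⟨ S ⟩ w)) (∑-δ z w) ⟩
    ∑⟨ S ⟩ w + w z ∎
    where open ≡-Reasoning

  ∑⟨⟩-full : ∀ {S} → (∀ v → S v ≡ true) → (w : V G → ℕ) → ∑⟨ S ⟩ w ≡ ∑ (enum G) w
  ∑⟨⟩-full full w =
    ∑-cong (enum G) (λ v → trans (cong (λ b → 𝟙 b * w v) (full v)) (+-identityʳ (w v)))

  dIn≡∑⟨⟩ : ∀ S v → dIn S v ≡ ∑⟨ S ⟩ (λ w → 𝟙 (adj G v w))
  dIn≡∑⟨⟩ S v = trans (count≡∑ _ (enum G))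
    (∑-cong (enum G) (λ w → trans (𝟙-∧ (adj G v w) (S w)) (*-comm (𝟙 (adj G v w)) (𝟙 (S w)))))

  dIn-insert : ∀ S {z} → S z ≡ false → ∀ v → dIn (insert z S) v ≡ dIn S v + 𝟙 (adj G v z)
  dIn-insert S {z} Sz v = begin
    dIn (insert z S) v                        ≡⟨ dIn≡∑⟨⟩ (insert z S) v ⟩
    ∑⟨ insert z S ⟩ (λ w → 𝟙 (adj G v w))    ≡⟨ ∑⟨insert⟩ S Sz _ ⟩
    ∑⟨ S ⟩ (λ w → 𝟙 (adj G v w)) + 𝟙 (adj G v z) ≡⟨ cong (_+ _) (sym (dIn≡∑⟨⟩ S v)) ⟩
    dIn S v + 𝟙 (adj G v z) ∎
    where open ≡-Reasoning

  -- The new vertex z contributes its edges into S once from each end.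
  degreeSumIn-insert : ∀ S {z} → S z ≡ false →
    degreeSumIn (insert z S) ≡ degreeSumIn S + 2 * dIn S z
  degreeSumIn-insert S {z} Sz = begin
    ∑⟨ insert z S ⟩ (dIn (insert z S))
      ≡⟨ ∑-cong (enum G) (λ v → cong (_*_ (𝟙 (insert z S v))) (dIn-insert S Sz v)) ⟩
    ∑⟨ insert z S ⟩ (λ v → dIn S v + 𝟙 (adj G v z))
      ≡⟨ ∑⟨insert⟩ S Sz _ ⟩
    ∑⟨ S ⟩ (λ v → dIn S v + 𝟙 (adj G v z)) + (dIn S z + 𝟙 (adj G z z))
      ≡⟨ cong₂ _+_ (∑⟨⟩-distrib-+ S _ _) (cong (λ b → dIn S z + 𝟙 b) (adj-irr G z)) ⟩
    (degreeSumIn S + ∑⟨ S ⟩ (λ v → 𝟙 (adj G v z))) + (dIn S z + 0)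
      ≡⟨ cong (λ d → (degreeSumIn S + d) + (dIn S z + 0)) inward≡dIn ⟩
    (degreeSumIn S + dIn S z) + (dIn S z + 0)
      ≡⟨ +-assoc (degreeSumIn S) (dIn S z) _ ⟩
    degreeSumIn S + 2 * dIn S z ∎
    where
    open ≡-Reasoning
    inward≡dIn : ∑⟨ S ⟩ (λ v → 𝟙 (adj G v z)) ≡ dIn S z
    inward≡dIn = trans (∑-cong (enum G) (λ v → cong (λ b → 𝟙 (S v) * 𝟙 b) (adj-sym G v z)))
                       (sym (dIn≡∑⟨⟩ S z))

  degreeSumIn-full : ∀ {S} → (∀ v → S v ≡ true) → degreeSumIn S ≡ degreeSum
  degreeSumIn-full {S} full = trans (∑⟨⟩-full full (dIn S))
    (∑-cong (enum G) (λ v → count-cong (enum G) (λ w →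
      trans (cong (adj G v w ∧_) (full w)) (∧-identityʳ _))))

  missing : Subset G → ℕ
  missing S = count (not ∘ S) (enum G)

  missing-insert : ∀ S {z} → S z ≡ false → missing S ≡ suc (missing (insert z S))
  missing-insert S {z} Sz = begin
    missing S
      ≡⟨ count≡∑ _ (enum G) ⟩
    ∑[ v ∈ enum G ] 𝟙 (not (S v))
      ≡⟨ ∑-cong (enum G) (𝟙-not-insert S Sz) ⟩
    ∑[ v ∈ enum G ] (𝟙 (not (insert z S v)) + 𝟙 ⌊ _≟V_ G z v ⌋)
      ≡⟨ ∑-distrib-+ (enum G) _ _ ⟩
    ∑[ v ∈ enum G ] 𝟙 (not (insert z S v)) + ∑[ v ∈ enum G ] 𝟙 ⌊ _≟V_ G z v ⌋
      ≡⟨ cong₂ _+_ (sym (count≡∑ _ (enum G)))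
                   (trans (∑-cong (enum G) (λ v → sym (*-identityʳ _))) (∑-δ z (λ _ → 1))) ⟩
    missing (insert z S) + 1
      ≡⟨ +-comm (missing (insert z S)) 1 ⟩
    suc (missing (insert z S)) ∎
    where open ≡-Reasoning

  grow : (P : Subset G → Set) →
    (∀ {S} → P S → (∃ λ v → S v ≡ false) → ∃ λ z → S z ≡ false × P (insert z S)) →
    ∀ {S} → P S → ∃ λ S → (∀ v → S v ≡ true) × P S
  grow P extend {S} PS = go (missing S) PS ≤-refl
    where
    go : ∀ n {S} → P S → missing S ≤ n → ∃ λ S → (∀ v → S v ≡ true) × P S
    go n {S} PS bound with any-vertex? (not ∘ S)
    ... | inj₂ none        = S , (λ v → not-injective (none v)) , PS
    ... | inj₁ (v , ¬Sv) with extend PS (v , not-injective ¬Sv)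
    ...   | z , Sz , PS′ = continue n (subst (_≤ n) (missing-insert S Sz) bound)
      where
      continue : ∀ n → suc (missing (insert z S)) ≤ n → ∃ λ S → (∀ v → S v ≡ true) × P S
      continue (suc n) bound′ = go n PS′ (≤-pred bound′)

  parking-mass-≤ : ∀ {q g} → IsParking G q g → 2 * mass g ≤ degreeSum
  parking-mass-≤ {q} {g} (_ , gq≡-1 , parks) = completed (grow Burnt extend {singleton q} from-root)
    where
    open ≤-Reasoning

    Burnt : Subset G → Set
    Burnt S = S q ≡ true × 2 * ∑⟨ S ⟩ (toℕ₊₁ ∘ g) ≤ degreeSumIn S

    from-root : Burnt (singleton q)
    from-root = ⌊≟⌋-refl q
          , subst (λ t → 2 * t ≤ _) (sym (trans (∑⟨singleton⟩ q _) (cong toℕ₊₁ gq≡-1))) z≤n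

    completed : (∃ λ S → (∀ v → S v ≡ true) × Burnt S) → 2 * mass g ≤ degreeSum
    completed (S , full , _ , bound) = begin
      2 * mass g                ≡⟨ cong (2 *_) (sym (∑⟨⟩-full full (toℕ₊₁ ∘ g))) ⟩
      2 * ∑⟨ S ⟩ (toℕ₊₁ ∘ g)    ≤⟨ bound ⟩
      degreeSumIn S             ≡⟨ degreeSumIn-full full ⟩
      degreeSum ∎

    extend : ∀ {S} → Burnt S → (∃ λ v → S v ≡ false) → ∃ λ z → S z ≡ false × Burnt (insert z S)
    extend {S} (Sq , bound) (v , Sv) with parks (not ∘ S) (cong not Sq) (v , cong not Sv)
    ... | z , ¬Sz , _ , gz<dOut = z , Sz , cong (_∨ _) Sq , (begin
      2 * ∑⟨ insert z S ⟩ (toℕ₊₁ ∘ g)          ≡⟨ cong (2 *_) (∑⟨insert⟩ S Sz _) ⟩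
      2 * (∑⟨ S ⟩ (toℕ₊₁ ∘ g) + toℕ₊₁ (g z))   ≡⟨ *-distribˡ-+ 2 (∑⟨ S ⟩ (toℕ₊₁ ∘ g)) _ ⟩
      2 * ∑⟨ S ⟩ (toℕ₊₁ ∘ g) + 2 * toℕ₊₁ (g z) ≤⟨ +-mono-≤ bound (*-monoʳ-≤ 2 gz+1≤dIn) ⟩
      degreeSumIn S + 2 * dIn S z              ≡⟨ sym (degreeSumIn-insert S Sz) ⟩
      degreeSumIn (insert z S) ∎)
      where
      Sz : S z ≡ false
      Sz = not-injective ¬Sz
      gz+1≤dIn : toℕ₊₁ (g z) ≤ dIn S z
      gz+1≤dIn = subst (toℕ₊₁ (g z) ≤_) (dOut-not S z) (<⇒toℕ₊₁≤ gz<dOut)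

  insert-self : ∀ S z → insert z S z ≡ true
  insert-self S z rewrite ⌊≟⌋-refl z = ∨-zeroʳ (S z)

  inserted-∈ : ∀ (A S : Subset G) {z v} →
    (A v ∧ insert z S v) ≡ true → (A v ∧ S v) ≡ false → A z ≡ true
  inserted-∈ A S {z} {v} h miss with A v in Av | S v | _≟V_ G z v
  inserted-∈ A S {z} {.z} h  miss | true  | false | yes refl = Av
  inserted-∈ A S {z} {v}  h  ()   | true  | true  | _
  inserted-∈ A S {z} {v}  () miss | true  | false | no _
  inserted-∈ A S {z} {v}  () miss | false | _     | _

  disjoint⇒dIn≤dOut : ∀ (A S : Subset G) → (∀ w → (A w ∧ S w) ≡ false) → ∀ z → dIn S z ≤ dOut G A z
  disjoint⇒dIn≤dOut A S disjoint z = count-mono (enum G) S-edge⇒out-edge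
    where
    S-edge⇒out-edge : ∀ w → (adj G z w ∧ S w) ≡ true → (adj G z w ∧ not (A w)) ≡ true
    S-edge⇒out-edge w h with adj G z w | S w | A w | disjoint w
    S-edge⇒out-edge w h  | true  | true  | false | _ = refl
    S-edge⇒out-edge w h  | true  | true  | true  | ()
    S-edge⇒out-edge w () | true  | false | _     | _
    S-edge⇒out-edge w () | false | _     | _     | _

  exit-vertex : ∀ {S a b} → Reachable G a b → S a ≡ true → S b ≡ false →
    ∃ λ z → S z ≡ false × 0 < dIn S z
  exit-vertex here Sa Sb with trans (sym Sa) Sb
  ... | ()
  exit-vertex {S} (there {u} {w} u~w w⇝b) Su Sb with S w in Sw
  ... | true  = exit-vertex w⇝b Sw Sb
  ... | false = w , Sw , count-∈ (λ y → adj G w y ∧ S y) (complete G u)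
                                 (cong₂ _∧_ (trans (adj-sym G w u) u~w) Su)

  -- A label is f + 1 for the parking function f under construction on the burnt set S.
  record Labelling (q : V G) (S : Subset G) : Set where
    field
      label       : V G → ℕ
      root-burnt  : S q ≡ true
      root-label  : label q ≡ 0
      label-sum   : degreeSumIn S ≤ 2 * ∑⟨ S ⟩ label
      label-parks : (A : Subset G) → A q ≡ false → (∃ λ v → (A v ∧ S v) ≡ true) →
                    ∃ λ v → A v ≡ true × S v ≡ true × 0 < label v × label v ≤ dOut G A v

  labelling-singleton : ∀ q → Labelling q (singleton q)
  labelling-singleton q = record
    { label       = λ _ → 0
    ; root-burnt  = ⌊≟⌋-refl q
    ; root-label  = refl
    ; label-sum   = subst (_≤ 2 * ∑⟨ singleton q ⟩ (λ _ → 0))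
                          (sym (trans (∑⟨singleton⟩ q _) (count-none (enum G) no-loop))) z≤n
    ; label-parks = λ A Aq (v , Av∧qv) → ⊥-elim (root-outside A Aq v Av∧qv)
    }
    where
    no-loop : ∀ w → (adj G q w ∧ ⌊ _≟V_ G q w ⌋) ≡ false
    no-loop w with _≟V_ G q w
    ... | yes refl = trans (∧-identityʳ _) (adj-irr G q)
    ... | no  _    = ∧-zeroʳ _
    root-outside : ∀ A → A q ≡ false → ∀ v → (A v ∧ ⌊ _≟V_ G q v ⌋) ≡ true → ⊥
    root-outside A Aq v Av∧qv with _≟V_ G q v
    ... | yes refl = case trans (sym (∧-conicalˡ _ _ Av∧qv)) Aq of λ ()
    ... | no  _    = case trans (sym (∧-zeroʳ (A v))) Av∧qv of λ ()

  labelling-insert : ∀ {q S z} → Labelling q S → S z ≡ false → 0 < dIn S z →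
    Labelling q (insert z S)
  labelling-insert {q} {S} {z} L Sz 0<dIn = record
    { label       = label′
    ; root-burnt  = cong (_∨ _) root-burnt
    ; root-label  = trans (label′-burnt root-burnt) root-label
    ; label-sum   = sum′
    ; label-parks = parks′
    }
    where
    open Labelling L
    label′ : V G → ℕ
    label′ v = if ⌊ _≟V_ G z v ⌋ then dIn S z else label v

    label′-burnt : ∀ {v} → S v ≡ true → label′ v ≡ label v
    label′-burnt {v} Sv with _≟V_ G z v
    ... | yes refl = case trans (sym Sv) Sz of λ ()
    ... | no  _    = refl

    label′-new : label′ z ≡ dIn S z
    label′-new rewrite ⌊≟⌋-refl z = refl

    sum′ : degreeSumIn (insert z S) ≤ 2 * ∑⟨ insert z S ⟩ label′
    sum′ = begin
      degreeSumIn (insert z S)            ≡⟨ degreeSumIn-insert S Sz ⟩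
      degreeSumIn S + 2 * dIn S z         ≤⟨ +-monoˡ-≤ (2 * dIn S z) label-sum ⟩
      2 * ∑⟨ S ⟩ label + 2 * dIn S z      ≡⟨ sym (*-distribˡ-+ 2 (∑⟨ S ⟩ label) _) ⟩
      2 * (∑⟨ S ⟩ label + dIn S z)
        ≡⟨ cong (2 *_) (sym (cong₂ _+_ (∑⟨⟩-cong S (λ _ → label′-burnt)) label′-new)) ⟩
      2 * (∑⟨ S ⟩ label′ + label′ z)      ≡⟨ cong (2 *_) (sym (∑⟨insert⟩ S Sz label′)) ⟩
      2 * ∑⟨ insert z S ⟩ label′ ∎
      where open ≤-Reasoning

    parks′ : (A : Subset G) → A q ≡ false → (∃ λ v → (A v ∧ insert z S v) ≡ true) →
      ∃ λ v → A v ≡ true × insert z S v ≡ true × 0 < label′ v × label′ v ≤ dOut G A v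
    parks′ A Aq (v , Av∧S′v) with any-vertex? (λ v → A v ∧ S v)
    ... | inj₁ meets-S with label-parks A Aq meets-S
    ...   | w , Aw , Sw , 0<lw , lw≤dOut =
            w , Aw , cong (_∨ _) Sw , subst (0 <_) (sym (label′-burnt Sw)) 0<lw
              , subst (_≤ dOut G A w) (sym (label′-burnt Sw)) lw≤dOut
    parks′ A Aq (v , Av∧S′v) | inj₂ avoids-S =
      z , inserted-∈ A S Av∧S′v (avoids-S v) , insert-self S z , subst (0 <_) (sym label′-new) 0<dIn
        , subst (_≤ dOut G A z) (sym label′-new) (disjoint⇒dIn≤dOut A S avoids-S z)

  connected⇒parking-mass-≥ : Connected G → (q : V G) →
    ∃ λ h → IsParking G q h × degreeSum ≤ 2 * mass h
  connected⇒parking-mass-≥ connected q =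
    completed (grow (Labelling q) extend {singleton q} (labelling-singleton q))
    where
    extend : ∀ {S} → Labelling q S → (∃ λ v → S v ≡ false) →
      ∃ λ z → S z ≡ false × Labelling q (insert z S)
    extend L (v , Sv) with exit-vertex (connected q v) (Labelling.root-burnt L) Sv
    ... | z , Sz , 0<dIn = z , Sz , labelling-insert L Sz 0<dIn

    completed : (∃ λ S → (∀ v → S v ≡ true) × Labelling q S) →
      ∃ λ h → IsParking G q h × degreeSum ≤ 2 * mass h
    completed (S , full , L) = fromℕ₋₁ ∘ label , parking , mass-bound
      where
      open Labelling L
      parking : IsParking G q (fromℕ₋₁ ∘ label)
      parking = (λ v → -1≤fromℕ₋₁ (label v)) , cong fromℕ₋₁ root-label , λ A Aq (v , Av) →
        let A∩S = trans (cong (A v ∧_) (full v)) (trans (∧-identityʳ (A v)) Av)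
            w , Aw , _ , 0<lw , lw≤dOut = label-parks A Aq (v , A∩S)
        in  w , Aw , 0<⇒0≤fromℕ₋₁ 0<lw , ≤⇒fromℕ₋₁< lw≤dOut
      mass-bound : degreeSum ≤ 2 * mass (fromℕ₋₁ ∘ label)
      mass-bound = begin
        degreeSum              ≡⟨ sym (degreeSumIn-full full) ⟩
        degreeSumIn S          ≤⟨ label-sum ⟩
        2 * ∑⟨ S ⟩ label       ≡⟨ cong (2 *_) (trans (∑⟨⟩-full full label)
                                    (∑-cong (enum G) (λ v → sym (toℕ₊₁-fromℕ₋₁ (label v))))) ⟩
        2 * mass (fromℕ₋₁ ∘ label) ∎
        where open ≤-Reasoning

  maxParking-mass-≥ : Connected G → ∀ {q f} → IsMaxParking G q f → degreeSum ≤ 2 * mass f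
  maxParking-mass-≥ connected {q} (f-parks , f-max) with connected⇒parking-mass-≥ connected q
  ... | h , h-parks , bound =
    ≤-trans bound (*-monoʳ-≤ 2 (total≤⇒mass≤ (proj₁ h-parks) (proj₁ f-parks) (f-max h h-parks)))

  mass-≥⇒maxParking : ∀ {q f} → IsParking G q f → degreeSum ≤ 2 * mass f → IsMaxParking G q f
  mass-≥⇒maxParking f-parks bound = f-parks , λ g g-parks →
    mass≤⇒total≤ (proj₁ g-parks) (proj₁ f-parks)
      (*-cancelˡ-≤ 2 (≤-trans (parking-mass-≤ g-parks) bound))

-- The Cartesian product

module _ (G₁ G₂ : Graph) where

  shadow : Subset (G₁ □ G₂) → Subset G₁
  shadow A u = ⌊ any? (λ v → A (u , v) ≟ᵇ true) (enum G₂) ⌋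

  shadow-intro : ∀ A {u v} → A (u , v) ≡ true → shadow A u ≡ true
  shadow-intro A {u} {v} Auv with any? (λ v → A (u , v) ≟ᵇ true) (enum G₂)
  ... | yes _    = refl
  ... | no  none = ⊥-elim (none (lose (complete G₂ v) Auv))

  shadow-elim : ∀ A {u} → shadow A u ≡ true → ∃ λ v → A (u , v) ≡ true
  shadow-elim A {u} h with any? (λ v → A (u , v) ≟ᵇ true) (enum G₂)
  ... | yes found = satisfied found

  shadow-false : ∀ A {u v} → shadow A u ≡ false → A (u , v) ≡ false
  shadow-false A {u} {v} h with A (u , v) in Auv
  ... | true  = case trans (sym (shadow-intro A Auv)) h of λ ()
  ... | false = refl

  adj-□-row : ∀ {u u′} v → adj G₁ u u′ ≡ true → adj (G₁ □ G₂) (u , v) (u′ , v) ≡ true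
  adj-□-row v u~u′ rewrite u~u′ | ⌊≟⌋-refl G₂ v = refl

  -- Edges from u to neighbours outside shadow A, and edges of the fibre {u} × G₂ leaving A,
  -- all leave A at (u , v).
  dOut-□-≥ : ∀ A u v →
    dOut G₁ (shadow A) u + dOut G₂ (λ v′ → A (u , v′)) v ≤ dOut (G₁ □ G₂) A (u , v)
  dOut-□-≥ A u v = begin
    dOut G₁ (shadow A) u + d₂
      ≡⟨ cong₂ _+_ (count≡∑ _ (enum G₁)) (sym (∑-δ G₁ u (λ _ → d₂))) ⟩
    ∑[ u′ ∈ enum G₁ ] 𝟙 (adj G₁ u u′ ∧ not (shadow A u′))
      + ∑[ u′ ∈ enum G₁ ] (𝟙 ⌊ _≟V_ G₁ u u′ ⌋ * d₂)
      ≡⟨ sym (∑-distrib-+ (enum G₁) _ _) ⟩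
    ∑[ u′ ∈ enum G₁ ] (𝟙 (adj G₁ u u′ ∧ not (shadow A u′)) + 𝟙 ⌊ _≟V_ G₁ u u′ ⌋ * d₂)
      ≤⟨ ∑-mono-≤ (enum G₁) fibre-≥ ⟩
    ∑[ u′ ∈ enum G₁ ] fibre u′
      ≡⟨ ∑-cong (enum G₁) (λ u′ → count≡∑ _ (enum G₂)) ⟩
    ∑[ u′ ∈ enum G₁ ] ∑[ v′ ∈ enum G₂ ] 𝟙 (adj (G₁ □ G₂) (u , v) (u′ , v′) ∧ not (A (u′ , v′)))
      ≡⟨ sym (trans (count≡∑ _ (enum (G₁ □ G₂))) (∑-cartesianProduct (enum G₁) (enum G₂) _)) ⟩
    dOut (G₁ □ G₂) A (u , v) ∎
    where
    open ≤-Reasoning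
    d₂ : ℕ
    d₂ = dOut G₂ (λ v′ → A (u , v′)) v
    fibre : V G₁ → ℕ
    fibre u′ = count (λ v′ → adj (G₁ □ G₂) (u , v) (u′ , v′) ∧ not (A (u′ , v′))) (enum G₂)
    fibre-edge : ∀ u′ → 𝟙 (adj G₁ u u′ ∧ not (shadow A u′)) ≤ fibre u′
    fibre-edge u′ with adj G₁ u u′ ∧ not (shadow A u′) in edge
    ... | false = z≤n
    ... | true  = count-∈ _ (complete G₂ v)
                    (cong₂ _∧_ (adj-□-row v (∧-conicalˡ _ _ edge))
                               (cong not (shadow-false A (not-injective (∧-conicalʳ _ _ edge)))))
    fibre-≥ : ∀ u′ → 𝟙 (adj G₁ u u′ ∧ not (shadow A u′)) + 𝟙 ⌊ _≟V_ G₁ u u′ ⌋ * d₂ ≤ fibre u′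
    fibre-≥ u′ with _≟V_ G₁ u u′ | fibre-edge u′
    ... | yes refl | _ rewrite adj-irr G₁ u | +-identityʳ d₂ = ≤-refl
    ... | no  _    | edge≤fibre =
      ≤-trans (≤-reflexive (+-identityʳ (𝟙 (adj G₁ u u′ ∧ not (shadow A u′))))) edge≤fibre

  𝟙-adj-□-≤ : ∀ u v u′ v′ → 𝟙 (adj (G₁ □ G₂) (u , v) (u′ , v′))
    ≤ 𝟙 ⌊ _≟V_ G₂ v v′ ⌋ * 𝟙 (adj G₁ u u′) + 𝟙 ⌊ _≟V_ G₁ u u′ ⌋ * 𝟙 (adj G₂ v v′)
  𝟙-adj-□-≤ u v u′ v′ =
    ≤-trans (𝟙-∨-≤ (adj G₁ u u′ ∧ ⌊ _≟V_ G₂ v v′ ⌋) (⌊ _≟V_ G₁ u u′ ⌋ ∧ adj G₂ v v′)) (+-mono-≤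
    (≤-reflexive (trans (𝟙-∧ (adj G₁ u u′) ⌊ _≟V_ G₂ v v′ ⌋) (*-comm (𝟙 (adj G₁ u u′)) _)))
    (≤-reflexive (𝟙-∧ ⌊ _≟V_ G₁ u u′ ⌋ (adj G₂ v v′))))

  deg-□-≤ : ∀ u v → deg (G₁ □ G₂) (u , v) ≤ deg G₁ u + deg G₂ v
  deg-□-≤ u v = begin
    deg (G₁ □ G₂) (u , v)
      ≡⟨ trans (count≡∑ _ (enum (G₁ □ G₂))) (∑-cartesianProduct (enum G₁) (enum G₂) _) ⟩
    ∑[ u′ ∈ enum G₁ ] ∑[ v′ ∈ enum G₂ ] 𝟙 (adj (G₁ □ G₂) (u , v) (u′ , v′))
      ≤⟨ ∑-mono-≤ (enum G₁) (λ u′ → ∑-mono-≤ (enum G₂) (𝟙-adj-□-≤ u v u′)) ⟩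
    ∑[ u′ ∈ enum G₁ ] ∑[ v′ ∈ enum G₂ ]
      (𝟙 ⌊ _≟V_ G₂ v v′ ⌋ * 𝟙 (adj G₁ u u′) + 𝟙 ⌊ _≟V_ G₁ u u′ ⌋ * 𝟙 (adj G₂ v v′))
      ≡⟨ ∑-cong (enum G₁) fibre-sum ⟩
    ∑[ u′ ∈ enum G₁ ] (𝟙 (adj G₁ u u′) + 𝟙 ⌊ _≟V_ G₁ u u′ ⌋ * deg G₂ v)
      ≡⟨ ∑-distrib-+ (enum G₁) _ _ ⟩
    ∑[ u′ ∈ enum G₁ ] 𝟙 (adj G₁ u u′) + ∑[ u′ ∈ enum G₁ ] (𝟙 ⌊ _≟V_ G₁ u u′ ⌋ * deg G₂ v)
      ≡⟨ cong₂ _+_ (sym (count≡∑ _ (enum G₁))) (∑-δ G₁ u (λ _ → deg G₂ v)) ⟩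
    deg G₁ u + deg G₂ v ∎
    where
    open ≤-Reasoning
    fibre-sum : ∀ u′ →
      ∑[ v′ ∈ enum G₂ ]
        (𝟙 ⌊ _≟V_ G₂ v v′ ⌋ * 𝟙 (adj G₁ u u′) + 𝟙 ⌊ _≟V_ G₁ u u′ ⌋ * 𝟙 (adj G₂ v v′))
      ≡ 𝟙 (adj G₁ u u′) + 𝟙 ⌊ _≟V_ G₁ u u′ ⌋ * deg G₂ v
    fibre-sum u′ = trans (∑-distrib-+ (enum G₂) (λ v′ → 𝟙 ⌊ _≟V_ G₂ v v′ ⌋ * 𝟙 (adj G₁ u u′)) _)
      (cong₂ _+_ (∑-δ G₂ v (λ _ → 𝟙 (adj G₁ u u′)))
                 (trans (∑-distribˡ-* (enum G₂) (𝟙 ⌊ _≟V_ G₁ u u′ ⌋) (𝟙 ∘ adj G₂ v))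
                        (cong (𝟙 ⌊ _≟V_ G₁ u u′ ⌋ *_) (sym (count≡∑ _ (enum G₂))))))

  degreeSum-□-≤ :
    degreeSum (G₁ □ G₂) ≤ length (enum G₂) * degreeSum G₁ + length (enum G₁) * degreeSum G₂
  degreeSum-□-≤ = begin
    degreeSum (G₁ □ G₂)                          ≡⟨ ∑-cartesianProduct (enum G₁) (enum G₂) _ ⟩
    ∑[ u ∈ enum G₁ ] ∑[ v ∈ enum G₂ ] deg (G₁ □ G₂) (u , v)
      ≤⟨ ∑-mono-≤ (enum G₁) (λ u → ∑-mono-≤ (enum G₂) (deg-□-≤ u)) ⟩
    ∑[ u ∈ enum G₁ ] ∑[ v ∈ enum G₂ ] (deg G₁ u + deg G₂ v) ≡⟨ ∑∑-separate (enum G₁) (enum G₂) _ _ ⟩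
    length (enum G₂) * degreeSum G₁ + length (enum G₁) * degreeSum G₂ ∎
    where open ≤-Reasoning

  module _ {f₁ : V G₁ → ℤ} {f₂ : V G₂ → ℤ}
           (-1≤f₁ : ∀ u → -[1+ 0 ] ℤ.≤ f₁ u) (-1≤f₂ : ∀ v → -[1+ 0 ] ℤ.≤ f₂ v) where

    toℕ₊₁-⊡ : ∀ u v → toℕ₊₁ ((_⊡_ {G₁} {G₂} f₁ f₂) (u , v)) ≡ toℕ₊₁ (f₁ u) + toℕ₊₁ (f₂ v)
    toℕ₊₁-⊡ u v = toℕ₊₁[a+b+1] (-1≤f₁ u) (-1≤f₂ v)

    mass-⊡ : mass (G₁ □ G₂) (_⊡_ {G₁} {G₂} f₁ f₂)
             ≡ length (enum G₂) * mass G₁ f₁ + length (enum G₁) * mass G₂ f₂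
    mass-⊡ = trans (∑-cartesianProduct (enum G₁) (enum G₂) _)
               (trans (∑-cong (enum G₁) (λ u → ∑-cong (enum G₂) (toℕ₊₁-⊡ u)))
                      (∑∑-separate (enum G₁) (enum G₂) _ _))

  ⊡-parking : ∀ {q₁ q₂ f₁ f₂} → IsParking G₁ q₁ f₁ → IsParking G₂ q₂ f₂ →
    IsParking (G₁ □ G₂) (q₁ , q₂) (_⊡_ {G₁} {G₂} f₁ f₂)
  ⊡-parking {q₁} {q₂} {f₁} {f₂} P₁@(-1≤f₁ , f₁q₁ , _) P₂@(-1≤f₂ , f₂q₂ , _) =
    (λ { (u , v) → -1≤a+b+1 (-1≤f₁ u) (-1≤f₂ v) }) , root , parks
    where
    F : V G₁ × V G₂ → ℤ
    F = _⊡_ {G₁} {G₂} f₁ f₂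

    root : F (q₁ , q₂) ≡ -[1+ 0 ]
    root rewrite f₁q₁ | f₂q₂ = refl

    parks : ∀ A → A (q₁ , q₂) ≡ false → (∃ λ w → A w ≡ true) →
      ∃ λ w → A w ≡ true × + 0 ℤ.≤ F w × F w ℤ.< + dOut (G₁ □ G₂) A w
    parks A Aq ((u₀ , v₀) , Au₀v₀)
      with parking-nonempty G₁ P₁ (shadow A) (u₀ , shadow-intro A Au₀v₀)
    ... | u , Uu , u-ok , f₁u<d₁ with parking-nonempty G₂ P₂ (λ v → A (u , v)) (shadow-elim A Uu)
    ... | v , Auv , v-ok , f₂v<d₂ = (u , v) , Auv , nonneg u-ok v-ok , strict
      where
      toℕ₊₁-F : toℕ₊₁ (F (u , v)) ≡ toℕ₊₁ (f₁ u) + toℕ₊₁ (f₂ v)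
      toℕ₊₁-F = toℕ₊₁-⊡ -1≤f₁ -1≤f₂ u v

      nonneg : u ≡ q₁ ⊎ + 0 ℤ.≤ f₁ u → v ≡ q₂ ⊎ + 0 ℤ.≤ f₂ v → + 0 ℤ.≤ F (u , v)
      nonneg (inj₁ u≡q₁) (inj₁ v≡q₂) =
        case trans (sym (subst (λ w → A w ≡ true) (cong₂ _,_ u≡q₁ v≡q₂) Auv)) Aq of λ ()
      nonneg (inj₂ 0≤f₁u) _ = 0<toℕ₊₁⇒0≤ (subst (0 <_) (sym toℕ₊₁-F)
                                (≤-trans (0≤⇒0<toℕ₊₁ 0≤f₁u) (m≤m+n _ (toℕ₊₁ (f₂ v)))))
      nonneg _ (inj₂ 0≤f₂v) = 0<toℕ₊₁⇒0≤ (subst (0 <_) (sym toℕ₊₁-F)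
                                (≤-trans (0≤⇒0<toℕ₊₁ 0≤f₂v) (m≤n+m _ (toℕ₊₁ (f₁ u)))))

      strict : F (u , v) ℤ.< + dOut (G₁ □ G₂) A (u , v)
      strict = toℕ₊₁≤⇒< (subst (_≤ _) (sym toℕ₊₁-F)
        (≤-trans (+-mono-≤ (<⇒toℕ₊₁≤ f₁u<d₁) (<⇒toℕ₊₁≤ f₂v<d₂)) (dOut-□-≥ A u v)))

  ⊡-mass-≥ : Connected G₁ → Connected G₂ → ∀ {q₁ q₂ f₁ f₂} →
    IsMaxParking G₁ q₁ f₁ → IsMaxParking G₂ q₂ f₂ →
    degreeSum (G₁ □ G₂) ≤ 2 * mass (G₁ □ G₂) (_⊡_ {G₁} {G₂} f₁ f₂)
  ⊡-mass-≥ connected₁ connected₂ {f₁ = f₁} {f₂} M₁ M₂ = begin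
    degreeSum (G₁ □ G₂)                                 ≤⟨ degreeSum-□-≤ ⟩
    n₂ * degreeSum G₁ + n₁ * degreeSum G₂
      ≤⟨ +-mono-≤ (*-monoʳ-≤ n₂ (maxParking-mass-≥ G₁ connected₁ M₁))
                  (*-monoʳ-≤ n₁ (maxParking-mass-≥ G₂ connected₂ M₂)) ⟩
    n₂ * (2 * mass G₁ f₁) + n₁ * (2 * mass G₂ f₂)
      ≡⟨ cong₂ _+_ (ℕ*.x∙yz≈y∙xz n₂ 2 _) (ℕ*.x∙yz≈y∙xz n₁ 2 _) ⟩
    2 * (n₂ * mass G₁ f₁) + 2 * (n₁ * mass G₂ f₂)
      ≡⟨ sym (*-distribˡ-+ 2 (n₂ * mass G₁ f₁) (n₁ * mass G₂ f₂)) ⟩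
    2 * (n₂ * mass G₁ f₁ + n₁ * mass G₂ f₂)
      ≡⟨ cong (2 *_) (sym (mass-⊡ (proj₁ (proj₁ M₁)) (proj₁ (proj₁ M₂)))) ⟩
    2 * mass (G₁ □ G₂) (_⊡_ {G₁} {G₂} f₁ f₂) ∎
    where
    open ≤-Reasoning
    n₁ n₂ : ℕ
    n₁ = length (enum G₁)
    n₂ = length (enum G₂)

mainTheorem10 : (G₁ G₂ : Graph) → Connected G₁ → Connected G₂ →
  (q₁ : V G₁) (q₂ : V G₂) (f₁ : V G₁ → ℤ) (f₂ : V G₂ → ℤ) →
  IsParking G₁ q₁ f₁ → IsParking G₂ q₂ f₂ →
  IsParking (G₁ □ G₂) (q₁ , q₂) (_⊡_ {G₁} {G₂} f₁ f₂) ×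
  (IsMaxParking G₁ q₁ f₁ → IsMaxParking G₂ q₂ f₂ →
   IsMaxParking (G₁ □ G₂) (q₁ , q₂) (_⊡_ {G₁} {G₂} f₁ f₂))
mainTheorem10 G₁ G₂ connected₁ connected₂ q₁ q₂ f₁ f₂ P₁ P₂ = parking , λ M₁ M₂ →
  mass-≥⇒maxParking (G₁ □ G₂) parking (⊡-mass-≥ G₁ G₂ connected₁ connected₂ M₁ M₂)
  where
  parking : IsParking (G₁ □ G₂) (q₁ , q₂) (_⊡_ {G₁} {G₂} f₁ f₂)
  parking = ⊡-parking G₁ G₂ P₁ P₂
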